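{- Let $f_n$ be the number of convex polyominoes of half-perimeter $n$ that are invariant under both a reflection in a horizontal axis and a reflection in a vertical axis. Then $f_1=0$, $f_2=1$, and for $n\ge3$, $f_n=3\cdot 2^{(n/2)-2}$ if $n$ is even and $f_n=2^{(n-1)/2}$ if $n$ is odd. Furthermore, $$\sum_{n\ge1}f_nt^n=\frac{t^2(t+1)^2}{1-2t^2}.$$
   Context: A polyomino is a finite edge-connected union of unit cells of the square lattice, up to translation; convex means its intersection with every horizontal and vertical line is connected. Half-perimeter is width plus height. Invariance under a reflection means the reflection maps the polyomino to a translate of itself. -}

module Defs where

open import Data.Nat using (ℕ; zero; suc; _+_; _*_; _∸_; _^_; _≤_; _<_)
open import Data.Nat.Properties using ()
open import Data.Fin using (Fin; fromℕ<)
open import Data.Bool using (Bool; true)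
open import Data.Vec using (Vec; lookup; reverse; map)
open import Data.List using (List; length)
open import Data.List.Membership.Propositional using (_∈_)
open import Data.List.Relation.Unary.Unique.Propositional using (Unique)
open import Data.Product using (Σ; ∃; _×_; _,_)
open import Data.Sum using (_⊎_)
open import Function.Bundles using (_⇔_)
open import Relation.Binary.PropositionalEquality using (_≡_)
open import Relation.Binary.Construct.Closure.ReflexiveTransitive using (Star)

-- A set of cells inside a w × h box: S[x][y] = true iff cell (x , y) is present
-- (x = column index in 0..w-1, y = row index in 0..h-1).
Grid : ℕ → ℕ → Set
Grid w h = Vec (Vec Bool h) w

Mem : ∀ {w h} → Grid w h → ℕ → ℕ → Set
Mem {w} {h} S x y =
  Σ (x < w) λ p → Σ (y < h) λ q → lookup (lookup S (fromℕ< p)) (fromℕ< q) ≡ true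

Cell : Set
Cell = ℕ × ℕ

Adj : Cell → Cell → Set
Adj (x , y) (x' , y') =
  (x ≡ x' × (suc y ≡ y' ⊎ suc y' ≡ y)) ⊎ (y ≡ y' × (suc x ≡ x' ⊎ suc x' ≡ x))

Step : ∀ {w h} → Grid w h → Cell → Cell → Set
Step S (x , y) (x' , y') = Mem S x y × Mem S x' y' × Adj (x , y) (x' , y')

IsPolyomino : ∀ {w h} → Grid w h → Set
IsPolyomino S =
  (∃ λ x → ∃ λ y → Mem S x y) ×
  (∀ x y x' y' → Mem S x y → Mem S x' y' → Star (Step S) (x , y) (x' , y'))

IsConvex : ∀ {w h} → Grid w h → Set
IsConvex S =
  (∀ x₁ x₂ x y → Mem S x₁ y → Mem S x₂ y → x₁ ≤ x → x ≤ x₂ → Mem S x y) ×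
  (∀ x y₁ y₂ y → Mem S x y₁ → Mem S x y₂ → y₁ ≤ y → y ≤ y₂ → Mem S x y)

-- the cell set touches all four sides of the w × h box, i.e. the box is its
-- bounding box, so its width is w and its height is h (normal form of a
-- polyomino up to translation)
FillsBox : ∀ {w h} → Grid w h → Set
FillsBox {w} {h} S =
  (∃ λ y → Mem S 0 y) × (∃ λ y → Mem S (w ∸ 1) y) ×
  (∃ λ x → Mem S x 0) × (∃ λ x → Mem S x (h ∸ 1))

-- invariance under reflection in a vertical axis (x ↦ -x) up to translation:
-- for a polyomino normalised to its bounding box this is reversal of columns
VertSymmetric : ∀ {w h} → Grid w h → Set
VertSymmetric S = reverse S ≡ S

-- invariance under reflection in a horizontal axis (y ↦ -y) up to translation
HorizSymmetric : ∀ {w h} → Grid w h → Set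
HorizSymmetric S = map reverse S ≡ S

-- polyominoes up to translation, represented by their normal form
NormPoly : Set
NormPoly = Σ (ℕ × ℕ) λ { (w , h) → Grid w h }

Counted : ℕ → NormPoly → Set
Counted n ((w , h) , S) =
  w + h ≡ n × IsPolyomino S × FillsBox S × IsConvex S ×
  VertSymmetric S × HorizSymmetric S

HasCount : {A : Set} → (A → Set) → ℕ → Set
HasCount {A} P k =
  Σ (List A) λ L → Unique L × length L ≡ k × (∀ a → (a ∈ L) ⇔ P a)

-- numerator t^2 (t+1)^2 = t^2 + 2 t^3 + t^4 : coefficient list
numCoeff : ℕ → ℕ
numCoeff 2 = 1
numCoeff 3 = 2
numCoeff 4 = 1
numCoeff _ = 0

-- coefficient of t^n in the power series t^2 (t+1)^2 / (1 - 2 t^2), i.e. the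
-- unique sequence g with g n - 2 g (n-2) = numCoeff n
gfCoeff : ℕ → ℕ
gfCoeff zero = numCoeff 0
gfCoeff (suc zero) = numCoeff 1
gfCoeff (suc (suc n)) = 2 * gfCoeff n + numCoeff (suc (suc n))

-- A convex polyomino invariant under both reflections is determined by one quadrant. Write the sides of
-- its bounding box as 2k + 1 + a and 2m + 1 + b with a, b ∈ {0, 1}. Symmetry plus convexity make the
-- membership of a cell depend only on its distances to the nearest vertical and the nearest horizontal
-- side of the box, monotonically; hence the central column and row are full, and the cells present in
-- the k × m corner quadrant form an up-closed set, i.e. the region above a lattice path of k right and
-- m down steps. So these polyominoes of half-perimeter n correspond to triples (a, b, path) with
-- 2(k + m) + a + b + 2 = n. The empty path gives the four rectangles 1×1, 2×1, 1×2 and 2×2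
-- (numerator t²(1 + t)²), and prepending a step adds 2 to the half-perimeter (factor 1 / (1 - 2t²)).

module Submission where

open import Defs
open import Data.Bool using (Bool; true; false)
open import Data.Bool.Properties using (T-≡; ⇔→≡)
open import Data.Empty using (⊥-elim)
import Data.Fin as Fin
open import Data.Fin using (Fin; toℕ; fromℕ<; fromℕ; inject₁; opposite)
open import Data.Fin.Properties using (toℕ-fromℕ<; toℕ<n; fromℕ<-toℕ; toℕ-injective; opposite-prop)
open import Data.List using (List; []; _∷_; _++_; length; map)
open import Data.List.Properties using (length-++; length-map)
open import Data.List.Membership.Propositional using (_∈_)
open import Data.List.Membership.Propositional.Properties using (∈-map⁺; ∈-map⁻; ∈-++⁺ˡ; ∈-++⁺ʳ; ∈-++⁻)
open import Data.List.Relation.Binary.Disjoint.Propositional using (Disjoint)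
open import Data.List.Relation.Unary.Any using (here; there)
open import Data.List.Relation.Unary.All using ([]; _∷_)
open import Data.List.Relation.Unary.AllPairs using ([]; _∷_)
open import Data.List.Relation.Unary.Unique.Propositional using (Unique)
open import Data.List.Relation.Unary.Unique.Propositional.Properties using (map⁺; ++⁺)
open import Data.Nat
  using (ℕ; zero; suc; _+_; _*_; _∸_; _^_; _≤_; _<_; _⊓_; _≤ᵇ_; _<?_; _≤?_; z≤n; s≤s)
open import Data.Nat using (_≤′_; ≤′-refl; ≤′-step)
open import Data.Nat.DivMod using (_/_; _%_; m≡m%n+[m/n]*n; m*n/n≡m)
open import Data.Nat.Properties
open import Data.Product using (Σ; ∃₂; _×_; _,_; proj₁; proj₂)
open import Data.Sum using (_⊎_; inj₁; inj₂; swap)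
import Data.Vec as Vec
open import Data.Vec using (Vec; []; _∷_; _∷ʳ_; lookup; tabulate; reverse)
open import Data.Vec.Properties using (lookup∘tabulate; tabulate∘lookup; tabulate-cong; lookup-map; reverse-∷)
open import Function using (_∘_)
open import Function.Bundles using (Equivalence; mk⇔)
open import Relation.Binary.Construct.Closure.ReflexiveTransitive
  using (Star; ε; _◅_; _◅◅_) renaming (reverse to Star-reverse)
open import Relation.Binary.PropositionalEquality
open import Relation.Nullary using (yes; no; contradiction)

private variable
  w h : ℕ

cell : Grid w h → ℕ → ℕ → Bool
cell {w} {h} S x y with x <? w | y <? h
... | yes x<w | yes y<h = lookup (lookup S (fromℕ< x<w)) (fromℕ< y<h)
... | _       | _       = false

cell-fromℕ< : (S : Grid w h) {x y : ℕ} (x<w : x < w) (y<h : y < h) →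
              cell S x y ≡ lookup (lookup S (fromℕ< x<w)) (fromℕ< y<h)
cell-fromℕ< {w} {h} S {x} {y} x<w y<h with x <? w | y <? h
... | yes _  | yes _  = refl
... | no x≮w | _      = contradiction x<w x≮w
... | yes _  | no y≮h = contradiction y<h y≮h

Mem⇒cell : (S : Grid w h) {x y : ℕ} → Mem S x y → cell S x y ≡ true
Mem⇒cell S (x<w , y<h , e) = trans (cell-fromℕ< S x<w y<h) e

cell⇒Mem : (S : Grid w h) {x y : ℕ} → cell S x y ≡ true → Mem S x y
cell⇒Mem {w} {h} S {x} {y} e with x <? w | y <? h
cell⇒Mem S e  | yes x<w | yes y<h = x<w , y<h , e
cell⇒Mem S () | no _    | _
cell⇒Mem S () | yes _   | no _

Mem⇔⇒cell≡ : (S : Grid w h) {x y x' y' : ℕ} →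
             (Mem S x y → Mem S x' y') → (Mem S x' y' → Mem S x y) → cell S x y ≡ cell S x' y'
Mem⇔⇒cell≡ S to from =
  ⇔→≡ (mk⇔ (Mem⇒cell S ∘ to ∘ cell⇒Mem S) (Mem⇒cell S ∘ from ∘ cell⇒Mem S))

lookup-ext : ∀ {A : Set} {n} (u v : Vec A n) → (∀ i → lookup u i ≡ lookup v i) → u ≡ v
lookup-ext u v eq = trans (sym (tabulate∘lookup u)) (trans (tabulate-cong eq) (tabulate∘lookup v))

grid-ext : (S S' : Grid w h) → (∀ {x y} → x < w → y < h → cell S x y ≡ cell S' x y) → S ≡ S'
grid-ext S S' eq = lookup-ext S S' λ i → lookup-ext _ _ λ j →
  trans (sym (cell-toℕ i j S)) (trans (eq (toℕ<n i) (toℕ<n j)) (cell-toℕ i j S'))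
  where
  cell-toℕ : ∀ i j (T : Grid w h) → cell T (toℕ i) (toℕ j) ≡ lookup (lookup T i) j
  cell-toℕ i j T = trans (cell-fromℕ< T (toℕ<n i) (toℕ<n j))
    (cong₂ (λ i' j' → lookup (lookup T i') j') (fromℕ<-toℕ i (toℕ<n i)) (fromℕ<-toℕ j (toℕ<n j)))

tabulateGrid : (w h : ℕ) → (ℕ → ℕ → Bool) → Grid w h
tabulateGrid w h f = tabulate λ i → tabulate λ j → f (toℕ i) (toℕ j)

cell-tabulateGrid : ∀ (f : ℕ → ℕ → Bool) {x y} → x < w → y < h → cell (tabulateGrid w h f) x y ≡ f x y
cell-tabulateGrid {w} {h} f x<w y<h = begin
  cell (tabulateGrid w h f) _ _
    ≡⟨ cell-fromℕ< (tabulateGrid w h f) x<w y<h ⟩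
  lookup (lookup (tabulateGrid w h f) (fromℕ< x<w)) (fromℕ< y<h)
    ≡⟨ cong (λ column → lookup column (fromℕ< y<h)) (lookup∘tabulate _ (fromℕ< x<w)) ⟩
  lookup (tabulate λ j → f (toℕ (fromℕ< x<w)) (toℕ j)) (fromℕ< y<h)
    ≡⟨ lookup∘tabulate _ (fromℕ< y<h) ⟩
  f (toℕ (fromℕ< x<w)) (toℕ (fromℕ< y<h))
    ≡⟨ cong₂ f (toℕ-fromℕ< x<w) (toℕ-fromℕ< y<h) ⟩
  f _ _
    ∎
  where open ≡-Reasoning

lookup-∷ʳ-fromℕ : ∀ {A : Set} {n} (x : A) (xs : Vec A n) → lookup (xs ∷ʳ x) (fromℕ n) ≡ x
lookup-∷ʳ-fromℕ x []       = refl
lookup-∷ʳ-fromℕ x (_ ∷ xs) = lookup-∷ʳ-fromℕ x xs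

lookup-∷ʳ-inject₁ : ∀ {A : Set} {n} (x : A) (xs : Vec A n) (i : Fin n) →
                    lookup (xs ∷ʳ x) (inject₁ i) ≡ lookup xs i
lookup-∷ʳ-inject₁ x (_ ∷ xs) Fin.zero    = refl
lookup-∷ʳ-inject₁ x (_ ∷ xs) (Fin.suc i) = lookup-∷ʳ-inject₁ x xs i

lookup-reverse : ∀ {A : Set} {n} (xs : Vec A n) (i : Fin n) → lookup (reverse xs) (opposite i) ≡ lookup xs i
lookup-reverse (x ∷ xs) i rewrite reverse-∷ x xs with i
... | Fin.zero  = lookup-∷ʳ-fromℕ x (reverse xs)
... | Fin.suc j = trans (lookup-∷ʳ-inject₁ x (reverse xs) (opposite j)) (lookup-reverse xs j)

mirror : ℕ → ℕ → ℕ
mirror w x = w ∸ suc x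

mirror< : ∀ {x} → x < w → mirror w x < w
mirror< {suc w} {x} _ = s≤s (m∸n≤m w x)

mirror-involutive : ∀ {x} → x < w → mirror w (mirror w x) ≡ x
mirror-involutive (s≤s x≤w) = m∸[m∸n]≡n x≤w

fromℕ<-mirror : ∀ {x} (x<w : x < w) → fromℕ< (mirror< x<w) ≡ opposite (fromℕ< x<w)
fromℕ<-mirror {w} x<w = toℕ-injective (begin
  toℕ (fromℕ< (mirror< x<w))   ≡⟨ toℕ-fromℕ< (mirror< x<w) ⟩
  mirror w _                    ≡⟨ cong (mirror w) (toℕ-fromℕ< x<w) ⟨
  mirror w (toℕ (fromℕ< x<w))  ≡⟨ opposite-prop (fromℕ< x<w) ⟨
  toℕ (opposite (fromℕ< x<w))  ∎)
  where open ≡-Reasoning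

cell-reverse : (S : Grid w h) {x y : ℕ} → x < w → y < h → cell (reverse S) (mirror w x) y ≡ cell S x y
cell-reverse S {y = y} x<w y<h = begin
  cell (reverse S) _ y
    ≡⟨ cell-fromℕ< (reverse S) (mirror< x<w) y<h ⟩
  lookup (lookup (reverse S) (fromℕ< (mirror< x<w))) (fromℕ< y<h)
    ≡⟨ cong (λ i → lookup (lookup (reverse S) i) (fromℕ< y<h)) (fromℕ<-mirror x<w) ⟩
  lookup (lookup (reverse S) (opposite (fromℕ< x<w))) (fromℕ< y<h)
    ≡⟨ cong (λ column → lookup column (fromℕ< y<h)) (lookup-reverse S (fromℕ< x<w)) ⟩
  lookup (lookup S (fromℕ< x<w)) (fromℕ< y<h)
    ≡⟨ cell-fromℕ< S x<w y<h ⟨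
  cell S _ y
    ∎
  where open ≡-Reasoning

cell-map-reverse : (S : Grid w h) {x y : ℕ} → x < w → y < h →
                   cell (Vec.map reverse S) x (mirror h y) ≡ cell S x y
cell-map-reverse S {x} x<w y<h = begin
  cell (Vec.map reverse S) x _
    ≡⟨ cell-fromℕ< (Vec.map reverse S) x<w (mirror< y<h) ⟩
  lookup (lookup (Vec.map reverse S) (fromℕ< x<w)) (fromℕ< (mirror< y<h))
    ≡⟨ cong₂ lookup (lookup-map (fromℕ< x<w) reverse S) (fromℕ<-mirror y<h) ⟩
  lookup (reverse (lookup S (fromℕ< x<w))) (opposite (fromℕ< y<h))
    ≡⟨ lookup-reverse (lookup S (fromℕ< x<w)) (fromℕ< y<h) ⟩
  lookup (lookup S (fromℕ< x<w)) (fromℕ< y<h)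
    ≡⟨ cell-fromℕ< S x<w y<h ⟨
  cell S x _
    ∎
  where open ≡-Reasoning

-- Distance to the nearer side

edgeDist : ℕ → ℕ → ℕ
edgeDist w x = x ⊓ mirror w x

edgeDist< : ∀ {x} → x < w → edgeDist w x < w
edgeDist< {x = x} x<w = ≤-<-trans (m⊓n≤m x _) x<w

edgeDist-mirror : ∀ {x} → x < w → edgeDist w (mirror w x) ≡ edgeDist w x
edgeDist-mirror {w} {x} x<w = trans (cong (mirror w x ⊓_) (mirror-involutive x<w)) (⊓-comm (mirror w x) x)

≤-mirror-swap : ∀ {x x'} → x' < w → x ≤ mirror w x' → x' ≤ mirror w x
≤-mirror-swap {suc w} {x} {x'} (s≤s x'≤w) x≤ =
  m+n≤o⇒m≤o∸n x' (subst (_≤ w) (+-comm x x') (m≤o∸n⇒m+n≤o x x'≤w x≤))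

edgeDist≤⇒between : ∀ {x x'} → x < w → x' < w → edgeDist w x ≤ edgeDist w x' →
                    (x ≤ x' × x' ≤ mirror w x) ⊎ (mirror w x ≤ x' × x' ≤ x)
edgeDist≤⇒between {w} {x} {x'} x<w x'<w ed≤ with ≤-total x (mirror w x)
... | inj₁ x≤x̄ = inj₁ (≤-trans x≤ed' (m⊓n≤m x' _) ,
        ≤-mirror-swap x'<w (≤-trans x≤ed' (m⊓n≤n x' _)))
  where x≤ed' = subst (_≤ edgeDist w x') (m≤n⇒m⊓n≡m x≤x̄) ed≤
... | inj₂ x̄≤x = inj₂ (≤-trans x̄≤ed' (m⊓n≤m x' _) ,
        subst (x' ≤_) (mirror-involutive x<w) (≤-mirror-swap x'<w (≤-trans x̄≤ed' (m⊓n≤n x' _))))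
  where x̄≤ed' = subst (_≤ edgeDist w x') (m≥n⇒m⊓n≡n x̄≤x) ed≤

between⇒edgeDist≤ : ∀ {x₁ x x₂} → x₁ ≤ x → x ≤ x₂ →
                    edgeDist w x₁ ≤ edgeDist w x ⊎ edgeDist w x₂ ≤ edgeDist w x
between⇒edgeDist≤ {w} {x₁} {x} {x₂} x₁≤x x≤x₂ with ≤-total x (mirror w x)
... | inj₁ x≤x̄ = inj₁ (≤-trans (m⊓n≤m x₁ _) (subst (x₁ ≤_) (sym (m≤n⇒m⊓n≡m x≤x̄)) x₁≤x))
... | inj₂ x̄≤x = inj₂ (≤-trans (m⊓n≤n x₂ _)
                        (subst (mirror w x₂ ≤_) (sym (m≥n⇒m⊓n≡n x̄≤x)) (∸-monoʳ-≤ w (s≤s x≤x₂))))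

-- k cells, a centre of one cell (c = false) or two (c = true), and k more cells
side : ℕ → Bool → ℕ
side zero    false = 1
side zero    true  = 2
side (suc k) c     = 2 + side k c

k+k<side : ∀ k c → k + k < side k c
k+k<side zero    false = s≤s z≤n
k+k<side zero    true  = s≤s z≤n
k+k<side (suc k) c rewrite +-suc k k = s≤s (s≤s (k+k<side k c))

side≤ : ∀ k c → side k c ≤ 2 + (k + k)
side≤ zero    false = s≤s z≤n
side≤ zero    true  = ≤-refl
side≤ (suc k) c rewrite +-suc k k = s≤s (s≤s (side≤ k c))

k<side : ∀ k c → k < side k c
k<side k c = ≤-<-trans (m≤m+n k k) (k+k<side k c)

side-surjective : ∀ w → 0 < w → ∃₂ λ k c → side k c ≡ w
side-surjective (suc zero)          _ = 0 , false , refl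
side-surjective (suc (suc zero))    _ = 0 , true , refl
side-surjective (suc (suc (suc w))) _ with side-surjective (suc w) (s≤s z≤n)
... | k , c , e = suc k , c , cong (2 +_) e

side-injective : ∀ {k c k' c'} → side k c ≡ side k' c' → k ≡ k' × c ≡ c'
side-injective {zero}  {false} {zero}   {false} _ = refl , refl
side-injective {zero}  {true}  {zero}   {true}  _ = refl , refl
side-injective {zero}  {true}  {suc k'} {c'}    e =
  contradiction (suc-injective (suc-injective e)) (<⇒≢ (≤-<-trans z≤n (k<side k' c')))
side-injective {suc k} {c}     {zero}   {true}  e =
  contradiction (suc-injective (suc-injective (sym e))) (<⇒≢ (≤-<-trans z≤n (k<side k c)))
side-injective {suc k} {c}     {suc k'} {c'}    e
  with side-injective {k} {c} {k'} {c'} (suc-injective (suc-injective e))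
... | refl , refl = refl , refl

edgeDist-side : ∀ {k c x} → x ≤ k → edgeDist (side k c) x ≡ x
edgeDist-side {k} {c} {x} x≤k = m≤n⇒m⊓n≡m (m+n≤o⇒m≤o∸n x (begin
  x + suc x    ≡⟨ +-suc x x ⟩
  suc (x + x)  ≤⟨ s≤s (+-mono-≤ x≤k x≤k) ⟩
  suc (k + k)  ≤⟨ k+k<side k c ⟩
  side k c     ∎))
  where open ≤-Reasoning

edgeDist-side-≤ : ∀ k c x → edgeDist (side k c) x ≤ k
edgeDist-side-≤ k c x with x ≤? k
... | yes x≤k = ≤-trans (m⊓n≤m x _) x≤k
... | no  x≰k = ≤-trans (m⊓n≤n x _) (begin
  side k c ∸ suc x  ≤⟨ ∸-mono (side≤ k c) (s≤s (≰⇒> x≰k)) ⟩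
  (k + k) ∸ k       ≡⟨ m+n∸n≡m k k ⟩
  k                 ∎)
  where open ≤-Reasoning

edgeDist-idempotent : ∀ k c x → edgeDist (side k c) (edgeDist (side k c) x) ≡ edgeDist (side k c) x
edgeDist-idempotent k c x = edgeDist-side (edgeDist-side-≤ k c x)

-- Convex doubly symmetric grids

convex-mirrorClosed⇒edgeDist-upward :
  (P : ℕ → Set) → (∀ {x} → P x → x < w) → (∀ {x} → P x → P (mirror w x)) →
  (∀ {x₁ x₂ x} → P x₁ → P x₂ → x₁ ≤ x → x ≤ x₂ → P x) →
  ∀ {x x'} → P x → x' < w → edgeDist w x ≤ edgeDist w x' → P x'
convex-mirrorClosed⇒edgeDist-upward P bounded mirror-closed convex Px x'<w ed≤
  with edgeDist≤⇒between (bounded Px) x'<w ed≤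
... | inj₁ (x≤x' , x'≤x̄) = convex Px (mirror-closed Px) x≤x' x'≤x̄
... | inj₂ (x̄≤x' , x'≤x) = convex (mirror-closed Px) Px x̄≤x' x'≤x

Mem-mirrorˣ : (S : Grid w h) → VertSymmetric S → ∀ {x y} → Mem S x y → Mem S (mirror w x) y
Mem-mirrorˣ {w} S symmetric {x} {y} m@(x<w , y<h , _) = cell⇒Mem S (begin
  cell S (mirror w x) y            ≡⟨ cong (λ T → cell T (mirror w x) y) symmetric ⟨
  cell (reverse S) (mirror w x) y  ≡⟨ cell-reverse S x<w y<h ⟩
  cell S x y                       ≡⟨ Mem⇒cell S m ⟩
  true                             ∎)
  where open ≡-Reasoning

Mem-mirrorʸ : (S : Grid w h) → HorizSymmetric S → ∀ {x y} → Mem S x y → Mem S x (mirror h y)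
Mem-mirrorʸ {h = h} S symmetric {x} {y} m@(x<w , y<h , _) = cell⇒Mem S (begin
  cell S x (mirror h y)                    ≡⟨ cong (λ T → cell T x (mirror h y)) symmetric ⟨
  cell (Vec.map reverse S) x (mirror h y)  ≡⟨ cell-map-reverse S x<w y<h ⟩
  cell S x y                               ≡⟨ Mem⇒cell S m ⟩
  true                                     ∎)
  where open ≡-Reasoning

EdgeMonotone : Grid w h → Set
EdgeMonotone {w} {h} S = ∀ {x y x' y'} → x' < w → y' < h →
  edgeDist w x ≤ edgeDist w x' → edgeDist h y ≤ edgeDist h y' → Mem S x y → Mem S x' y'

convex-symmetric⇒edgeMonotone : (S : Grid w h) → IsConvex S → VertSymmetric S → HorizSymmetric S →
                                EdgeMonotone S
convex-symmetric⇒edgeMonotone S (row-convex , column-convex) vsym hsym {x} {y} {x'} x'<w y'<h edˣ≤ edʸ≤ m =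
  convex-mirrorClosed⇒edgeDist-upward (Mem S x') (proj₁ ∘ proj₂) (Mem-mirrorʸ S hsym)
    (λ m₁ m₂ → column-convex _ _ _ _ m₁ m₂) along-row y'<h edʸ≤
  where
  along-row : Mem S x' y
  along-row = convex-mirrorClosed⇒edgeDist-upward (λ x → Mem S x y) proj₁ (Mem-mirrorˣ S vsym)
    (λ m₁ m₂ → row-convex _ _ _ _ m₁ m₂) m x'<w edˣ≤

edgeMonotone⇒convex : (S : Grid w h) → EdgeMonotone S → IsConvex S
edgeMonotone⇒convex {w} {h} S mono = row-convex , column-convex
  where
  row-convex : ∀ x₁ x₂ x y → Mem S x₁ y → Mem S x₂ y → x₁ ≤ x → x ≤ x₂ → Mem S x y
  row-convex x₁ x₂ x y m₁ m₂ x₁≤x x≤x₂ with between⇒edgeDist≤ {w} x₁≤x x≤x₂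
  ... | inj₁ ed≤ = mono (≤-<-trans x≤x₂ (proj₁ m₂)) (proj₁ (proj₂ m₁)) ed≤ ≤-refl m₁
  ... | inj₂ ed≤ = mono (≤-<-trans x≤x₂ (proj₁ m₂)) (proj₁ (proj₂ m₂)) ed≤ ≤-refl m₂
  column-convex : ∀ x y₁ y₂ y → Mem S x y₁ → Mem S x y₂ → y₁ ≤ y → y ≤ y₂ → Mem S x y
  column-convex x y₁ y₂ y m₁ m₂ y₁≤y y≤y₂ with between⇒edgeDist≤ {h} y₁≤y y≤y₂
  ... | inj₁ ed≤ = mono (proj₁ m₁) (≤-<-trans y≤y₂ (proj₁ (proj₂ m₂))) ≤-refl ed≤ m₁
  ... | inj₂ ed≤ = mono (proj₁ m₂) (≤-<-trans y≤y₂ (proj₁ (proj₂ m₂))) ≤-refl ed≤ m₂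

edgeMonotone⇒cell≡ : (S : Grid w h) → EdgeMonotone S →
                     ∀ {x y x' y'} → x < w → y < h → x' < w → y' < h →
                     edgeDist w x ≡ edgeDist w x' → edgeDist h y ≡ edgeDist h y' → cell S x y ≡ cell S x' y'
edgeMonotone⇒cell≡ S mono x<w y<h x'<w y'<h edˣ edʸ = Mem⇔⇒cell≡ S
  (mono x'<w y'<h (≤-reflexive edˣ) (≤-reflexive edʸ))
  (mono x<w y<h (≤-reflexive (sym edˣ)) (≤-reflexive (sym edʸ)))

edgeMonotone⇒vertSymmetric : (S : Grid w h) → EdgeMonotone S → VertSymmetric S
edgeMonotone⇒vertSymmetric {w} S mono = grid-ext (reverse S) S λ {x} {y} x<w y<h → begin
  cell (reverse S) x y
    ≡⟨ cong (λ x → cell (reverse S) x y) (mirror-involutive x<w) ⟨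
  cell (reverse S) (mirror w (mirror w x)) y
    ≡⟨ cell-reverse S (mirror< x<w) y<h ⟩
  cell S (mirror w x) y
    ≡⟨ edgeMonotone⇒cell≡ S mono (mirror< x<w) y<h x<w y<h (edgeDist-mirror x<w) refl ⟩
  cell S x y
    ∎
  where open ≡-Reasoning

edgeMonotone⇒horizSymmetric : (S : Grid w h) → EdgeMonotone S → HorizSymmetric S
edgeMonotone⇒horizSymmetric {h = h} S mono = grid-ext (Vec.map reverse S) S λ {x} {y} x<w y<h → begin
  cell (Vec.map reverse S) x y
    ≡⟨ cong (cell (Vec.map reverse S) x) (mirror-involutive y<h) ⟨
  cell (Vec.map reverse S) x (mirror h (mirror h y))
    ≡⟨ cell-map-reverse S x<w (mirror< y<h) ⟩
  cell S x (mirror h y)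
    ≡⟨ edgeMonotone⇒cell≡ S mono x<w (mirror< y<h) x<w y<h refl (edgeDist-mirror y<h) ⟩
  cell S x y
    ∎
  where open ≡-Reasoning

Adj-sym : ∀ {a b} → Adj a b → Adj b a
Adj-sym (inj₁ (x≡x' , step)) = inj₁ (sym x≡x' , swap step)
Adj-sym (inj₂ (y≡y' , step)) = inj₂ (sym y≡y' , swap step)

Step-sym : (S : Grid w h) → ∀ {a b} → Step S a b → Step S b a
Step-sym S (m , m' , adj) = m' , m , Adj-sym adj

column-walk : (S : Grid w h) → IsConvex S → ∀ {x y y'} → y ≤′ y' → Mem S x y → Mem S x y' →
              Star (Step S) (x , y) (x , y')
column-walk S convex ≤′-refl _ _ = ε
column-walk S convex {x} {y} (≤′-step {n} y≤′n) m m' =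
  column-walk S convex y≤′n m mₙ ◅◅ (mₙ , m' , inj₁ (refl , inj₁ refl)) ◅ ε
  where mₙ = proj₂ convex x y (suc n) n m m' (≤′⇒≤ y≤′n) (n≤1+n n)

row-walk : (S : Grid w h) → IsConvex S → ∀ {x x' y} → x ≤′ x' → Mem S x y → Mem S x' y →
           Star (Step S) (x , y) (x' , y)
row-walk S convex ≤′-refl _ _ = ε
row-walk S convex {x} {y = y} (≤′-step {n} x≤′n) m m' =
  row-walk S convex x≤′n m mₙ ◅◅ (mₙ , m' , inj₂ (refl , inj₁ refl)) ◅ ε
  where mₙ = proj₁ convex x (suc n) n y m m' (≤′⇒≤ x≤′n) (n≤1+n n)

column-path : (S : Grid w h) → IsConvex S → ∀ {x y y'} → Mem S x y → Mem S x y' →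
              Star (Step S) (x , y) (x , y')
column-path S convex {y = y} {y'} m m' with ≤-total y y'
... | inj₁ y≤y' = column-walk S convex (≤⇒≤′ y≤y') m m'
... | inj₂ y'≤y = Star-reverse (Step-sym S) (column-walk S convex (≤⇒≤′ y'≤y) m' m)

row-path : (S : Grid w h) → IsConvex S → ∀ {x x' y} → Mem S x y → Mem S x' y →
           Star (Step S) (x , y) (x' , y)
row-path S convex {x} {x'} m m' with ≤-total x x'
... | inj₁ x≤x' = row-walk S convex (≤⇒≤′ x≤x') m m'
... | inj₂ x'≤x = Star-reverse (Step-sym S) (row-walk S convex (≤⇒≤′ x'≤x) m' m)

convex-fullRow⇒connected : (S : Grid w h) → IsConvex S → ∀ r → (∀ {x} → x < w → Mem S x r) →
                           ∀ x y x' y' → Mem S x y → Mem S x' y' → Star (Step S) (x , y) (x' , y')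
convex-fullRow⇒connected S convex r full x y x' y' m m' =
  column-path S convex m mᵣ ◅◅ row-path S convex mᵣ mᵣ' ◅◅ column-path S convex mᵣ' m'
  where
  mᵣ  = full (proj₁ m)
  mᵣ' = full (proj₁ m')

-- Staircases

≤⇒≤ᵇ≡true : ∀ {m n} → m ≤ n → (m ≤ᵇ n) ≡ true
≤⇒≤ᵇ≡true m≤n = Equivalence.to T-≡ (≤⇒≤ᵇ m≤n)

≤ᵇ≡true⇒≤ : ∀ m n → (m ≤ᵇ n) ≡ true → m ≤ n
≤ᵇ≡true⇒≤ m n e = ≤ᵇ⇒≤ m n (Equivalence.from T-≡ e)

data Move : Set where
  right down : Move

Staircase : Set
Staircase = List Move

rights : Staircase → ℕ
rights []          = 0
rights (right ∷ s) = suc (rights s)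
rights (down ∷ s)  = rights s

downs : Staircase → ℕ
downs []          = 0
downs (right ∷ s) = downs s
downs (down ∷ s)  = suc (downs s)

-- above s i j: cell (i , j) lies above the lattice path that runs from (0 , downs s) to (rights s , 0)
-- with the moves s; over column 0 the path is at the height of its first right move.
above : Staircase → ℕ → ℕ → Bool
above []          _       _ = true
above (right ∷ s) zero    j = downs s ≤ᵇ j
above (right ∷ s) (suc i) j = above s i j
above (down ∷ s)  i       j = above s i j

above-outside : ∀ s {i j} → rights s ≤ i ⊎ downs s ≤ j → above s i j ≡ true
above-outside []                  _                = refl
above-outside (right ∷ s) {zero}  (inj₂ downs≤j)   = ≤⇒≤ᵇ≡true downs≤j
above-outside (right ∷ s) {suc i} (inj₁ (s≤s r≤i)) = above-outside s (inj₁ r≤i)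
above-outside (right ∷ s) {suc i} (inj₂ downs≤j)   = above-outside s (inj₂ downs≤j)
above-outside (down ∷ s)          (inj₁ rights≤i)  = above-outside s (inj₁ rights≤i)
above-outside (down ∷ s)          (inj₂ downs<j)   = above-outside s (inj₂ (<⇒≤ downs<j))

above-monotone : ∀ s {i j i' j'} → i ≤ i' → j ≤ j' → above s i j ≡ true → above s i' j' ≡ true
above-monotone []                                  _          _    _ = refl
above-monotone (right ∷ s) {zero}  {i' = zero}     _          j≤j' e =
  ≤⇒≤ᵇ≡true (≤-trans (≤ᵇ≡true⇒≤ (downs s) _ e) j≤j')
above-monotone (right ∷ s) {zero}  {i' = suc _}    _          j≤j' e =
  above-outside s (inj₂ (≤-trans (≤ᵇ≡true⇒≤ (downs s) _ e) j≤j'))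
above-monotone (right ∷ s) {suc i} {i' = suc i'}   (s≤s i≤i') j≤j' e = above-monotone s i≤i' j≤j' e
above-monotone (down ∷ s)                          i≤i'       j≤j' e = above-monotone s i≤i' j≤j' e

UpClosed : ℕ → ℕ → (ℕ → ℕ → Bool) → Set
UpClosed k m p = ∀ {i j i' j'} → i' < k → j' < m → i ≤ i' → j ≤ j' → p i j ≡ true → p i' j' ≡ true

-- The top-left cell of the box decides the first move: if it is missing then so is the whole first
-- column, and the path starts by moving right; if it is present then so is the whole top row, and the
-- path starts by moving down.
upClosed⇒staircase : ∀ k m (p : ℕ → ℕ → Bool) → UpClosed k m p →
                     Σ Staircase λ s → rights s ≡ k × downs s ≡ m ×
                                       (∀ {i j} → i < k → j < m → above s i j ≡ p i j)
upClosed⇒staircase zero    zero    p _ = [] , refl , refl , λ ()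
upClosed⇒staircase zero    (suc m) p _ with upClosed⇒staircase zero m p (λ ())
... | s , r , d , _ = down ∷ s , r , cong suc d , λ ()
upClosed⇒staircase (suc k) zero    p _ with upClosed⇒staircase k zero p (λ _ ())
... | s , r , d , _ = right ∷ s , cong suc r , d , λ _ ()
upClosed⇒staircase (suc k) (suc m) p up with p 0 m in p₀ₘ
... | false with upClosed⇒staircase k (suc m) (λ i j → p (suc i) j)
                   (λ i'<k j'<m i≤i' j≤j' → up (s≤s i'<k) j'<m (s≤s i≤i') j≤j')
...   | s , r , d , agree = right ∷ s , cong suc r , d , agree'
  where
  agree' : ∀ {i j} → i < suc k → j < suc m → above (right ∷ s) i j ≡ p i j
  agree' {zero}  {j} _ j<m = ⇔→≡ (mk⇔
    (λ e → contradiction (subst (_≤ j) d (≤ᵇ≡true⇒≤ (downs s) j e)) (<⇒≱ j<m))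
    (λ e → contradiction (trans (sym (up (s≤s z≤n) ≤-refl ≤-refl (m<1+n⇒m≤n j<m) e)) p₀ₘ) λ ()))
  agree' {suc i} (s≤s i<k) j<m = agree i<k j<m
upClosed⇒staircase (suc k) (suc m) p up | true with upClosed⇒staircase (suc k) m p
                   (λ i'<k j'<m i≤i' j≤j' → up i'<k (m<n⇒m<1+n j'<m) i≤i' j≤j')
...   | s , r , d , agree = down ∷ s , r , cong suc d , agree'
  where
  agree' : ∀ {i j} → i < suc k → j < suc m → above (down ∷ s) i j ≡ p i j
  agree' i<k j<m with m<1+n⇒m<n∨m≡n j<m
  ... | inj₁ j<m' = agree i<k j<m'
  ... | inj₂ refl = trans (above-outside s (inj₂ (≤-reflexive d))) (sym (up i<k ≤-refl z≤n ≤-refl p₀ₘ))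

first-moves-differ : ∀ s s' → downs s ≡ suc (downs s') →
                     above (right ∷ s) 0 (downs s') ≢ above (down ∷ s') 0 (downs s')
first-moves-differ s s' d e = <⇒≱ (≤-reflexive (sym d))
  (≤ᵇ≡true⇒≤ (downs s) (downs s') (trans e (above-outside s' (inj₂ ≤-refl))))

above-injective : ∀ s s' → rights s ≡ rights s' → downs s ≡ downs s' →
                  (∀ {i j} → i < rights s → j < downs s → above s i j ≡ above s' i j) → s ≡ s'
above-injective []          []           _ _  _     = refl
above-injective []          (right ∷ s') () _  _
above-injective []          (down ∷ s')  _  () _
above-injective (right ∷ s) []           () _  _
above-injective (down ∷ s)  []           _  () _
above-injective (right ∷ s) (right ∷ s') r  d  agree =
  cong (right ∷_) (above-injective s s' (suc-injective r) d λ i<k j<m → agree (s≤s i<k) j<m)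
above-injective (down ∷ s)  (down ∷ s')  r  d  agree =
  cong (down ∷_) (above-injective s s' r (suc-injective d) λ i<k j<m → agree i<k (m<n⇒m<1+n j<m))
above-injective (right ∷ s) (down ∷ s')  _  d  agree =
  ⊥-elim (first-moves-differ s s' d (agree (s≤s z≤n) (≤-reflexive (sym d))))
above-injective (down ∷ s)  (right ∷ s') r  d  agree =
  ⊥-elim (first-moves-differ s' s (sym d) (sym (agree (subst (0 <_) (sym r) (s≤s z≤n)) ≤-refl)))

-- Shapes and their polyominoes

record Shape : Set where
  constructor shape
  field
    wideCentre tallCentre : Bool
    staircase             : Staircase

open Shape

width height halfPerimeter : Shape → ℕ
width  (shape c _ s) = side (rights s) c
height (shape _ d s) = side (downs s) d
halfPerimeter σ = width σ + height σ

shapeGrid : (σ : Shape) → Grid (width σ) (height σ)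
shapeGrid σ = tabulateGrid (width σ) (height σ) λ x y →
  above (staircase σ) (edgeDist (width σ) x) (edgeDist (height σ) y)

toPolyomino : Shape → NormPoly
toPolyomino σ = (width σ , height σ) , shapeGrid σ

cell-shapeGrid : ∀ σ {x y} → x < width σ → y < height σ →
                 cell (shapeGrid σ) x y ≡ above (staircase σ) (edgeDist (width σ) x) (edgeDist (height σ) y)
cell-shapeGrid σ = cell-tabulateGrid _

cell-shapeGrid-quadrant : ∀ c d s {i j} → i ≤ rights s → j ≤ downs s →
                          cell (shapeGrid (shape c d s)) i j ≡ above s i j
cell-shapeGrid-quadrant c d s i≤k j≤m =
  trans (cell-shapeGrid (shape c d s) (≤-<-trans i≤k (k<side _ c)) (≤-<-trans j≤m (k<side _ d)))
        (cong₂ (above s) (edgeDist-side i≤k) (edgeDist-side j≤m))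

shapeGrid-edgeMonotone : ∀ σ → EdgeMonotone (shapeGrid σ)
shapeGrid-edgeMonotone σ x'<w y'<h edˣ≤ edʸ≤ m@(x<w , y<h , _) = cell⇒Mem (shapeGrid σ)
  (trans (cell-shapeGrid σ x'<w y'<h) (above-monotone (staircase σ) edˣ≤ edʸ≤
    (trans (sym (cell-shapeGrid σ x<w y<h)) (Mem⇒cell (shapeGrid σ) m))))

shapeGrid-centreRow : ∀ σ {x} → x < width σ → Mem (shapeGrid σ) x (downs (staircase σ))
shapeGrid-centreRow σ@(shape c d s) x<w = cell⇒Mem (shapeGrid σ)
  (trans (cell-shapeGrid σ x<w (k<side _ d)) (above-outside s (inj₂ (≤-reflexive (sym (edgeDist-side ≤-refl))))))

shapeGrid-centreColumn : ∀ σ {y} → y < height σ → Mem (shapeGrid σ) (rights (staircase σ)) y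
shapeGrid-centreColumn σ@(shape c d s) y<h = cell⇒Mem (shapeGrid σ)
  (trans (cell-shapeGrid σ (k<side _ c) y<h) (above-outside s (inj₁ (≤-reflexive (sym (edgeDist-side ≤-refl))))))

shapeGrid-fillsBox : ∀ σ → FillsBox (shapeGrid σ)
shapeGrid-fillsBox σ@(shape c d s) =
  (downs s , shapeGrid-centreRow σ (0<side (rights s) c)) ,
  (downs s , shapeGrid-centreRow σ (side∸1<side (rights s) c)) ,
  (rights s , shapeGrid-centreColumn σ (0<side (downs s) d)) ,
  (rights s , shapeGrid-centreColumn σ (side∸1<side (downs s) d))
  where
  0<side : ∀ k c → 0 < side k c
  0<side k c = ≤-<-trans z≤n (k<side k c)
  side∸1<side : ∀ k c → side k c ∸ 1 < side k c
  side∸1<side k c = ∸-monoʳ-< {o = 0} (s≤s z≤n) (0<side k c)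

toPolyomino-counted : ∀ σ → Counted (halfPerimeter σ) (toPolyomino σ)
toPolyomino-counted σ = refl , polyomino , shapeGrid-fillsBox σ , convex ,
  edgeMonotone⇒vertSymmetric (shapeGrid σ) (shapeGrid-edgeMonotone σ) ,
  edgeMonotone⇒horizSymmetric (shapeGrid σ) (shapeGrid-edgeMonotone σ)
  where
  convex : IsConvex (shapeGrid σ)
  convex = edgeMonotone⇒convex (shapeGrid σ) (shapeGrid-edgeMonotone σ)
  polyomino : IsPolyomino (shapeGrid σ)
  polyomino = (0 , _ , shapeGrid-centreRow σ (≤-<-trans z≤n (k<side (rights (staircase σ)) (wideCentre σ)))) ,
              convex-fullRow⇒connected (shapeGrid σ) convex _ (shapeGrid-centreRow σ)

cellOf : NormPoly → ℕ → ℕ → Bool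
cellOf (_ , S) = cell S

toPolyomino-injective : ∀ {σ σ'} → toPolyomino σ ≡ toPolyomino σ' → σ ≡ σ'
toPolyomino-injective {shape c d s} {shape c' d' s'} eq
  with side-injective {rights s} {c} {rights s'} {c'} (cong (proj₁ ∘ proj₁) eq)
     | side-injective {downs s} {d} {downs s'} {d'} (cong (proj₂ ∘ proj₁) eq)
... | r≡ , refl | d≡ , refl = cong (shape c d) (above-injective s s' r≡ d≡ λ {i} {j} i<k j<m → begin
  above s i j
    ≡⟨ cell-shapeGrid-quadrant c d s (<⇒≤ i<k) (<⇒≤ j<m) ⟨
  cellOf (toPolyomino (shape c d s)) i j
    ≡⟨ cong (λ P → cellOf P i j) eq ⟩
  cellOf (toPolyomino (shape c d s')) i j
    ≡⟨ cell-shapeGrid-quadrant c d s' (subst (i ≤_) r≡ (<⇒≤ i<k)) (subst (j ≤_) d≡ (<⇒≤ j<m)) ⟩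
  above s' i j
    ∎)
  where open ≡-Reasoning

module _ {k c m d} (S : Grid (side k c) (side m d)) (mono : EdgeMonotone S) where

  private
    ≤⇒<side : ∀ {i n b} → i ≤ n → i < side n b
    ≤⇒<side {n = n} {b} i≤n = ≤-<-trans i≤n (k<side n b)

    edgeDist-side-mono : ∀ {n b i i'} → i ≤ i' → i' ≤ n → edgeDist (side n b) i ≤ edgeDist (side n b) i'
    edgeDist-side-mono i≤i' i'≤n =
      subst₂ _≤_ (sym (edgeDist-side (≤-trans i≤i' i'≤n))) (sym (edgeDist-side i'≤n)) i≤i'

    edgeDist≤centre : ∀ n b x → edgeDist (side n b) x ≤ edgeDist (side n b) n
    edgeDist≤centre n b x = ≤-trans (edgeDist-side-≤ n b x) (≤-reflexive (sym (edgeDist-side ≤-refl)))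

  edgeMonotone-centreColumn : ∀ {x₀} → Mem S x₀ 0 → ∀ {y} → y < side m d → Mem S k y
  edgeMonotone-centreColumn {x₀} m₀ y<h = mono (≤⇒<side ≤-refl) y<h (edgeDist≤centre k c x₀) z≤n m₀

  edgeMonotone-centreRow : ∀ {y₀} → Mem S 0 y₀ → ∀ {x} → x < side k c → Mem S x m
  edgeMonotone-centreRow {y₀} m₀ x<w = mono x<w (≤⇒<side ≤-refl) z≤n (edgeDist≤centre m d y₀) m₀

  edgeMonotone-upClosed : UpClosed k m (cell S)
  edgeMonotone-upClosed i'<k j'<m i≤i' j≤j' e = Mem⇒cell S
    (mono (≤⇒<side (<⇒≤ i'<k)) (≤⇒<side (<⇒≤ j'<m))
          (edgeDist-side-mono i≤i' (<⇒≤ i'<k)) (edgeDist-side-mono j≤j' (<⇒≤ j'<m)) (cell⇒Mem S e))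

  cell-edgeDist : ∀ {x y} → x < side k c → y < side m d →
                  cell S x y ≡ cell S (edgeDist (side k c) x) (edgeDist (side m d) y)
  cell-edgeDist {x} {y} x<w y<h = edgeMonotone⇒cell≡ S mono x<w y<h (edgeDist< x<w) (edgeDist< y<h)
    (sym (edgeDist-idempotent k c x)) (sym (edgeDist-idempotent m d y))

  edgeMonotone⇒staircase :
    ∀ {x₀ y₀} → Mem S x₀ 0 → Mem S 0 y₀ →
    Σ Staircase λ s → rights s ≡ k × downs s ≡ m ×
      (∀ {x y} → x < side k c → y < side m d →
                 cell S x y ≡ above s (edgeDist (side k c) x) (edgeDist (side m d) y))
  edgeMonotone⇒staircase bottom left with upClosed⇒staircase k m (cell S) edgeMonotone-upClosed
  ... | s , r , dn , agree = s , r , dn , λ {x} {y} x<w y<h →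
    trans (cell-edgeDist x<w y<h) (on-quadrant (edgeDist-side-≤ k c x) (edgeDist-side-≤ m d y))
    where
    on-quadrant : ∀ {i j} → i ≤ k → j ≤ m → cell S i j ≡ above s i j
    on-quadrant i≤k j≤m with m≤n⇒m<n∨m≡n i≤k | m≤n⇒m<n∨m≡n j≤m
    ... | inj₁ i<k  | inj₁ j<m  = sym (agree i<k j<m)
    ... | inj₂ refl | _         = trans (Mem⇒cell S (edgeMonotone-centreColumn bottom (≤⇒<side j≤m)))
                                        (sym (above-outside s (inj₁ (≤-reflexive r))))
    ... | inj₁ _    | inj₂ refl = trans (Mem⇒cell S (edgeMonotone-centreRow left (≤⇒<side i≤k)))
                                        (sym (above-outside s (inj₂ (≤-reflexive dn))))

toPolyomino-surjective : ∀ {w h} (S : Grid w h) → FillsBox S → IsConvex S →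
                         VertSymmetric S → HorizSymmetric S → Σ Shape λ σ → toPolyomino σ ≡ ((w , h) , S)
toPolyomino-surjective {w} {h} S ((_ , left) , _ , (_ , bottom) , _) convex vsym hsym
  with side-surjective w (≤-<-trans z≤n (proj₁ left))
     | side-surjective h (≤-<-trans z≤n (proj₁ (proj₂ bottom)))
... | k , c , refl | m , d , refl
  with edgeMonotone⇒staircase {k} {c} {m} {d} S (convex-symmetric⇒edgeMonotone S convex vsym hsym) bottom left
... | s , refl , refl , agree =
  shape c d s , cong (_ ,_) (grid-ext (shapeGrid (shape c d s)) S λ x<w y<h →
    trans (cell-shapeGrid (shape c d s) x<w y<h) (sym (agree x<w y<h)))

-- Enumeration by half-perimeter

extend : Move → Shape → Shape
extend x (shape c d s) = shape c d (x ∷ s)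

extend-injective : ∀ {x σ τ} → extend x σ ≡ extend x τ → σ ≡ τ
extend-injective refl = refl

halfPerimeter-extend : ∀ x σ → halfPerimeter (extend x σ) ≡ 2 + halfPerimeter σ
halfPerimeter-extend right σ = refl
halfPerimeter-extend down  σ = trans (+-suc (width σ) _) (cong suc (+-suc (width σ) _))

emptyStaircaseShapes : ℕ → List Shape
emptyStaircaseShapes 2 = shape false false [] ∷ []
emptyStaircaseShapes 3 = shape true false [] ∷ shape false true [] ∷ []
emptyStaircaseShapes 4 = shape true true [] ∷ []
emptyStaircaseShapes _ = []

emptyStaircaseShapes-sound : ∀ n {σ} → σ ∈ emptyStaircaseShapes n → halfPerimeter σ ≡ n × staircase σ ≡ []
emptyStaircaseShapes-sound 2 (here refl)         = refl , refl
emptyStaircaseShapes-sound 3 (here refl)         = refl , refl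
emptyStaircaseShapes-sound 3 (there (here refl)) = refl , refl
emptyStaircaseShapes-sound 4 (here refl)         = refl , refl

emptyStaircaseShapes-unique : ∀ n → Unique (emptyStaircaseShapes n)
emptyStaircaseShapes-unique 0                               = []
emptyStaircaseShapes-unique 1                               = []
emptyStaircaseShapes-unique 2                               = [] ∷ []
emptyStaircaseShapes-unique 3                               = ((λ ()) ∷ []) ∷ [] ∷ []
emptyStaircaseShapes-unique 4                               = [] ∷ []
emptyStaircaseShapes-unique (suc (suc (suc (suc (suc _))))) = []

length-emptyStaircaseShapes : ∀ n → length (emptyStaircaseShapes n) ≡ numCoeff n
length-emptyStaircaseShapes 0                               = refl
length-emptyStaircaseShapes 1                               = refl
length-emptyStaircaseShapes 2                               = refl
length-emptyStaircaseShapes 3                               = refl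
length-emptyStaircaseShapes 4                               = refl
length-emptyStaircaseShapes (suc (suc (suc (suc (suc _))))) = refl

shapes : ℕ → List Shape
shapes (suc (suc n)) = emptyStaircaseShapes (2 + n) ++ map (extend right) (shapes n) ++ map (extend down) (shapes n)
shapes _             = []

∈-extended : ∀ x {τ : Shape} {L} → τ ∈ L → extend x τ ∈ map (extend right) L ++ map (extend down) L
∈-extended right τ∈ = ∈-++⁺ˡ (∈-map⁺ (extend right) τ∈)
∈-extended down  τ∈ = ∈-++⁺ʳ (map (extend right) _) (∈-map⁺ (extend down) τ∈)

shapes-complete : ∀ σ → σ ∈ shapes (halfPerimeter σ)
shapes-complete (shape false false []) = here refl
shapes-complete (shape true  false []) = here refl
shapes-complete (shape false true  []) = there (here refl)
shapes-complete (shape true  true  []) = here refl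
shapes-complete (shape c d (x ∷ s))    =
  subst (λ n → extend x (shape c d s) ∈ shapes n) (sym (halfPerimeter-extend x (shape c d s)))
    (∈-++⁺ʳ (emptyStaircaseShapes (2 + halfPerimeter (shape c d s)))
            (∈-extended x (shapes-complete (shape c d s))))

shapes-sound : ∀ n {σ} → σ ∈ shapes n → halfPerimeter σ ≡ n
shapes-sound (suc (suc n)) σ∈ with ∈-++⁻ (emptyStaircaseShapes (2 + n)) σ∈
... | inj₁ σ∈E = proj₁ (emptyStaircaseShapes-sound (2 + n) σ∈E)
... | inj₂ σ∈X with ∈-++⁻ (map (extend right) (shapes n)) σ∈X
...   | inj₁ σ∈R with ∈-map⁻ (extend right) σ∈R
...     | τ , τ∈ , refl = trans (halfPerimeter-extend right τ) (cong (2 +_) (shapes-sound n τ∈))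
shapes-sound (suc (suc n)) σ∈ | inj₂ _ | inj₂ σ∈D with ∈-map⁻ (extend down) σ∈D
...     | τ , τ∈ , refl = trans (halfPerimeter-extend down τ) (cong (2 +_) (shapes-sound n τ∈))

shapes-unique : ∀ n → Unique (shapes n)
shapes-unique 0             = []
shapes-unique 1             = []
shapes-unique (suc (suc n)) = ++⁺ (emptyStaircaseShapes-unique (2 + n))
  (++⁺ (map⁺ extend-injective (shapes-unique n)) (map⁺ extend-injective (shapes-unique n)) right-down-disjoint)
  empty-extended-disjoint
  where
  R = map (extend right) (shapes n)
  D = map (extend down) (shapes n)
  right-down-disjoint : Disjoint R D
  right-down-disjoint (σ∈R , σ∈D) with ∈-map⁻ (extend right) σ∈R | ∈-map⁻ (extend down) σ∈D
  ... | _ , _ , refl | _ , _ , ()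
  empty-extended-disjoint : Disjoint (emptyStaircaseShapes (2 + n)) (R ++ D)
  empty-extended-disjoint (σ∈E , σ∈X) with proj₂ (emptyStaircaseShapes-sound (2 + n) σ∈E) | ∈-++⁻ R σ∈X
  ... | empty | inj₁ σ∈R with ∈-map⁻ (extend right) σ∈R
  ...   | _ , _ , refl = contradiction empty λ ()
  empty-extended-disjoint (σ∈E , σ∈X) | empty | inj₂ σ∈D with ∈-map⁻ (extend down) σ∈D
  ...   | _ , _ , refl = contradiction empty λ ()

length-shapes : ∀ n → length (shapes n) ≡ gfCoeff n
length-shapes 0             = refl
length-shapes 1             = refl
length-shapes (suc (suc n)) = begin
  length (E ++ R ++ D)
    ≡⟨ length-++ E ⟩
  length E + length (R ++ D)
    ≡⟨ cong (length E +_) (length-++ R) ⟩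
  length E + (length R + length D)
    ≡⟨ cong₂ (λ e r → e + (r + length D)) (length-emptyStaircaseShapes (2 + n)) (length-extended right) ⟩
  numCoeff (2 + n) + (gfCoeff n + length D)
    ≡⟨ cong (λ d → numCoeff (2 + n) + (gfCoeff n + d)) (length-extended down) ⟩
  numCoeff (2 + n) + (gfCoeff n + gfCoeff n)
    ≡⟨ +-comm (numCoeff (2 + n)) _ ⟩
  gfCoeff n + gfCoeff n + numCoeff (2 + n)
    ≡⟨ cong (λ g → gfCoeff n + g + numCoeff (2 + n)) (+-identityʳ (gfCoeff n)) ⟨
  gfCoeff (2 + n)
    ∎
  where
  open ≡-Reasoning
  E = emptyStaircaseShapes (2 + n)
  R = map (extend right) (shapes n)
  D = map (extend down) (shapes n)
  length-extended : ∀ x → length (map (extend x) (shapes n)) ≡ gfCoeff n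
  length-extended x = trans (length-map (extend x) (shapes n)) (length-shapes n)

hasCount-map-injective : ∀ {A B : Set} {P : B → Set} (f : A → B) → (∀ {a a'} → f a ≡ f a' → a ≡ a') →
                         (L : List A) → Unique L → (∀ {a} → a ∈ L → P (f a)) →
                         (∀ {b} → P b → Σ A λ a → a ∈ L × f a ≡ b) → HasCount P (length L)
hasCount-map-injective {P = P} f f-injective L unique sound complete =
  map f L , map⁺ f-injective unique , length-map f L , λ b → mk⇔ (to b) (from b)
  where
  to : ∀ b → b ∈ map f L → P b
  to b b∈ with ∈-map⁻ f b∈
  ... | a , a∈ , refl = sound a∈
  from : ∀ b → P b → b ∈ map f L
  from b Pb with complete Pb
  ... | a , a∈ , refl = ∈-map⁺ f a∈

count : ∀ n → HasCount (Counted n) (gfCoeff n)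
count n = subst (HasCount (Counted n)) (length-shapes n)
  (hasCount-map-injective toPolyomino toPolyomino-injective (shapes n) (shapes-unique n) sound complete)
  where
  sound : ∀ {σ} → σ ∈ shapes n → Counted n (toPolyomino σ)
  sound {σ} σ∈ = subst (λ k → Counted k (toPolyomino σ)) (shapes-sound n σ∈) (toPolyomino-counted σ)
  complete : ∀ {P} → Counted n P → Σ Shape λ σ → σ ∈ shapes n × toPolyomino σ ≡ P
  complete {(w , h) , S} (size , _ , fills , convex , vsym , hsym)
    with toPolyomino-surjective S fills convex vsym hsym
  ... | σ , refl = σ , subst (λ k → σ ∈ shapes k) size (shapes-complete σ) , refl

gfCoeff-[2+q]*2 : ∀ q → gfCoeff ((2 + q) * 2) ≡ 3 * 2 ^ q
gfCoeff-[2+q]*2 zero    = refl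
gfCoeff-[2+q]*2 (suc q) = begin
  2 * gfCoeff ((2 + q) * 2) + 0  ≡⟨ +-identityʳ _ ⟩
  2 * gfCoeff ((2 + q) * 2)      ≡⟨ cong (2 *_) (gfCoeff-[2+q]*2 q) ⟩
  2 * (3 * 2 ^ q)                ≡⟨ *-assoc 2 3 (2 ^ q) ⟨
  3 * 2 * 2 ^ q                  ≡⟨ *-assoc 3 2 (2 ^ q) ⟩
  3 * 2 ^ (1 + q)                ∎
  where open ≡-Reasoning

gfCoeff-1+[1+q]*2 : ∀ q → gfCoeff (1 + (1 + q) * 2) ≡ 2 ^ (1 + q)
gfCoeff-1+[1+q]*2 zero    = refl
gfCoeff-1+[1+q]*2 (suc q) = trans (+-identityʳ _) (cong (2 *_) (gfCoeff-1+[1+q]*2 q))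

gfCoeff-even : ∀ n → 3 ≤ n → n % 2 ≡ 0 → gfCoeff n ≡ 3 * 2 ^ (n / 2 ∸ 2)
gfCoeff-even n 3≤n even with n / 2 | trans (m≡m%n+[m/n]*n n 2) (cong (_+ n / 2 * 2) even)
... | 0           | refl = contradiction 3≤n λ ()
... | 1           | refl = contradiction 3≤n λ { (s≤s (s≤s ())) }
... | suc (suc q) | refl = gfCoeff-[2+q]*2 q

gfCoeff-odd : ∀ n → 3 ≤ n → n % 2 ≡ 1 → gfCoeff n ≡ 2 ^ ((n ∸ 1) / 2)
gfCoeff-odd n 3≤n odd with n / 2 | trans (m≡m%n+[m/n]*n n 2) (cong (_+ n / 2 * 2) odd)
... | 0     | refl = contradiction 3≤n λ { (s≤s ()) }
... | suc q | refl = trans (gfCoeff-1+[1+q]*2 q) (cong (2 ^_) (sym (m*n/n≡m (suc q) 2)))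

mainTheorem19 : HasCount (Counted 1) 0 ×
    HasCount (Counted 2) 1 ×
    (∀ n → 3 ≤ n → n % 2 ≡ 0 → HasCount (Counted n) (3 * 2 ^ (n / 2 ∸ 2))) ×
    (∀ n → 3 ≤ n → n % 2 ≡ 1 → HasCount (Counted n) (2 ^ ((n ∸ 1) / 2))) ×
    (∀ n → 1 ≤ n → HasCount (Counted n) (gfCoeff n))
mainTheorem19 =
  count 1 ,
  count 2 ,
  (λ n 3≤n even → subst (HasCount (Counted n)) (gfCoeff-even n 3≤n even) (count n)) ,
  (λ n 3≤n odd  → subst (HasCount (Counted n)) (gfCoeff-odd n 3≤n odd) (count n)) ,
  λ n _ → count n
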